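{- $\{11184810s+3292241 : s=0,1,2,\dots\}\subseteq\mathcal{U}$.
   Context: $\mathcal{U}$ denotes the set of positive odd integers $n$ that cannot be written as $n=p+2^k$ with $p$ a prime and $k$ a positive integer. -}

module Defs where

open import Data.Nat using (ℕ; suc; _+_; _^_; _<_; _≡ᵇ_)
open import Data.Nat.Primality using (Prime)
open import Data.Nat.Divisibility using (_∤_)
open import Data.Product using (_×_; ∃-syntax)
open import Relation.Nullary using (¬_)
open import Relation.Binary.PropositionalEquality using (_≡_)

RomanoffRep : ℕ → Set
RomanoffRep n = ∃[ p ] ∃[ j ] (Prime p × n ≡ p + 2 ^ suc j)

InU : ℕ → Set
InU n = (0 < n) × (2 ∤ n) × ¬ RomanoffRep n

-- Write n = 11184810 s + 3292241 and D = 5592405 = 3 · 5 · 7 · 13 · 17 · 241, so that 11184810 = 2 D and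
-- n is odd. Every prime factor q of D divides 2^24 − 1, so 2^k mod q depends only on k mod 24, and for
-- each residue r of k mod 24 one of these primes q satisfies 2^r ≡ n (mod q). Hence if n = p + 2^k with
-- p prime then q ∣ p, i.e. p = q; but then a second prime q′ ∣ D shows n ≢ q + 2^k (mod q′).
module Submission where

open import Defs
open import Data.Nat using (ℕ; _+_; _*_)
open import Data.Nat.Base using (zero; suc; _^_; _%_; _/_; _<_; s≤s; z≤n; NonZero; NonTrivial; nonTrivial⇒≢1)
open import Data.Nat.Properties
open import Data.Nat.DivMod
open import Data.Nat.Divisibility
open import Data.Nat.Primality using (Prime; prime⇒irreducible)
open import Data.Product using (_,_)
open import Data.List using (upTo)
open import Data.List.Relation.Unary.All as All using (All; _∷_; [])
open import Data.List.Membership.Propositional.Properties using (∈-upTo⁺)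
open import Data.Sum using (inj₁; inj₂)
open import Relation.Nullary using (¬_; contradiction)
open import Relation.Binary.PropositionalEquality

n%d≡1⇒[m*n]%d≡m%d : ∀ m {n} d .{{_ : NonZero d}} → n % d ≡ 1 → (m * n) % d ≡ m % d
n%d≡1⇒[m*n]%d≡m%d m {n} d n%d≡1 = begin
  (m * n) % d               ≡⟨ %-distribˡ-* m n d ⟩
  (m % d * (n % d)) % d     ≡⟨ cong (λ x → (m % d * x) % d) n%d≡1 ⟩
  (m % d * 1) % d           ≡⟨ cong (_% d) (*-identityʳ (m % d)) ⟩
  m % d % d                 ≡⟨ m%n%n≡m%n m d ⟩
  m % d                     ∎
  where open ≡-Reasoning

n%d≡1⇒n^k%d≡1 : ∀ {n} d .{{_ : NonZero d}} → n % d ≡ 1 → ∀ k → (n ^ k) % d ≡ 1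
n%d≡1⇒n^k%d≡1 {n} d n%d≡1 zero = begin
  1 % d         ≡⟨ n%d≡1⇒[m*n]%d≡m%d 1 d n%d≡1 ⟨
  (1 * n) % d   ≡⟨ cong (_% d) (*-identityˡ n) ⟩
  n % d         ≡⟨ n%d≡1 ⟩
  1             ∎
  where open ≡-Reasoning
n%d≡1⇒n^k%d≡1 {n} d n%d≡1 (suc k) =
  trans (n%d≡1⇒[m*n]%d≡m%d n d (n%d≡1⇒n^k%d≡1 d n%d≡1 k)) n%d≡1

m^e%d≡1⇒m^k%d≡m^[k%e]%d : ∀ m e d .{{_ : NonZero e}} .{{_ : NonZero d}} →
                          (m ^ e) % d ≡ 1 → ∀ k → (m ^ k) % d ≡ (m ^ (k % e)) % d
m^e%d≡1⇒m^k%d≡m^[k%e]%d m e d m^e%d≡1 k = begin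
  (m ^ k) % d                                 ≡⟨ cong (λ x → (m ^ x) % d) (m≡m%n+[m/n]*n k e) ⟩
  (m ^ (k % e + k / e * e)) % d               ≡⟨ cong (_% d) (^-distribˡ-+-* m (k % e) (k / e * e)) ⟩
  (m ^ (k % e) * m ^ (k / e * e)) % d         ≡⟨ cong (λ x → (m ^ (k % e) * m ^ x) % d) (*-comm (k / e) e) ⟩
  (m ^ (k % e) * m ^ (e * (k / e))) % d       ≡⟨ cong (λ x → (m ^ (k % e) * x) % d) (^-*-assoc m e (k / e)) ⟨
  (m ^ (k % e) * (m ^ e) ^ (k / e)) % d       ≡⟨ n%d≡1⇒[m*n]%d≡m%d _ d (n%d≡1⇒n^k%d≡1 d m^e%d≡1 (k / e)) ⟩
  (m ^ (k % e)) % d                           ∎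
  where open ≡-Reasoning

m∣n∧o%n≡p%n⇒o%m≡p%m : ∀ {m n} o p .{{_ : NonZero m}} .{{_ : NonZero n}} →
                      m ∣ n → o % n ≡ p % n → o % m ≡ p % m
m∣n∧o%n≡p%n⇒o%m≡p%m {m} {n} o p m∣n o≡p = begin
  o % m       ≡⟨ m∣n⇒o%n%m≡o%m m n o m∣n ⟨
  o % n % m   ≡⟨ cong (_% m) o≡p ⟩
  p % n % m   ≡⟨ m∣n⇒o%n%m≡o%m m n p m∣n ⟩
  p % m       ∎
  where open ≡-Reasoning

[m+n]%d≡n%d⇒d∣m : ∀ m n d .{{_ : NonZero d}} → (m + n) % d ≡ n % d → d ∣ m
[m+n]%d≡n%d⇒d∣m m n d eq = ∣m+n∣m⇒∣n (subst (d ∣_) quotients (n∣m*n ((m + n) / d))) (n∣m*n (n / d))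
  where
  open ≡-Reasoning
  quotients : (m + n) / d * d ≡ n / d * d + m
  quotients = +-cancelˡ-≡ (n % d) _ _ (begin
    n % d + (m + n) / d * d        ≡⟨ cong (_+ (m + n) / d * d) eq ⟨
    (m + n) % d + (m + n) / d * d  ≡⟨ m≡m%n+[m/n]*n (m + n) d ⟨
    m + n                          ≡⟨ +-comm m n ⟩
    n + m                          ≡⟨ cong (_+ m) (m≡m%n+[m/n]*n n d) ⟩
    n % d + n / d * d + m          ≡⟨ +-assoc (n % d) _ m ⟩
    n % d + (n / d * d + m)        ∎)

∣-prime⇒≡ : ∀ {d p} .{{_ : NonTrivial d}} → Prime p → d ∣ p → d ≡ p
∣-prime⇒≡ p-prime d∣p with prime⇒irreducible p-prime d∣p
... | inj₁ d≡1 = contradiction d≡1 nonTrivial⇒≢1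
... | inj₂ d≡p = d≡p

D R : ℕ
D = 5592405
R = 3292241

record Covering (r : ℕ) : Set where
  constructor cover
  field
    q q′ : ℕ
    {{q-nonZero}} : NonZero q
    {{q-nonTrivial}} : NonTrivial q
    {{q′-nonZero}} : NonZero q′
    D%q≡0 : D % q ≡ 0
    D%q′≡0 : D % q′ ≡ 0
    hit : (2 ^ r) % q ≡ R % q
    miss : (q + 2 ^ r) % q′ ≢ R % q′

coverings : All Covering (upTo 24)
coverings =
  cover 5 7 refl refl refl (λ ())
  ∷ cover 3 7 refl refl refl (λ ())
  ∷ cover 13 7 refl refl refl (λ ())
  ∷ cover 3 7 refl refl refl (λ ())
  ∷ cover 5 7 refl refl refl (λ ())
  ∷ cover 3 7 refl refl refl (λ ())
  ∷ cover 7 13 refl refl refl (λ ())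
  ∷ cover 3 7 refl refl refl (λ ())
  ∷ cover 5 7 refl refl refl (λ ())
  ∷ cover 3 7 refl refl refl (λ ())
  ∷ cover 17 7 refl refl refl (λ ())
  ∷ cover 3 7 refl refl refl (λ ())
  ∷ cover 5 7 refl refl refl (λ ())
  ∷ cover 3 7 refl refl refl (λ ())
  ∷ cover 13 7 refl refl refl (λ ())
  ∷ cover 3 7 refl refl refl (λ ())
  ∷ cover 5 7 refl refl refl (λ ())
  ∷ cover 3 7 refl refl refl (λ ())
  ∷ cover 7 13 refl refl refl (λ ())
  ∷ cover 3 7 refl refl refl (λ ())
  ∷ cover 5 7 refl refl refl (λ ())
  ∷ cover 3 7 refl refl refl (λ ())
  ∷ cover 241 7 refl refl refl (λ ())
  ∷ cover 3 7 refl refl refl (λ ())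
  ∷ []

covering : ∀ k → Covering (k % 24)
covering k = All.lookup coverings (∈-upTo⁺ (m%n<n k 24))

2^k%d≡2^[k%24]%d : ∀ k d .{{_ : NonZero d}} → d ∣ D → (2 ^ k) % d ≡ (2 ^ (k % 24)) % d
2^k%d≡2^[k%24]%d k d d∣D =
  m∣n∧o%n≡p%n⇒o%m≡p%m (2 ^ k) (2 ^ (k % 24)) d∣D (m^e%d≡1⇒m^k%d≡m^[k%e]%d 2 24 D refl k)

¬RomanoffRep : ∀ n → n % D ≡ R % D → ¬ RomanoffRep n
¬RomanoffRep n n%D≡R%D (p , j , p-prime , n≡p+2^k) = miss q+2^r%q′≡R%q′
  where
  open Covering (covering (suc j))
  open ≡-Reasoning
  instance
    q≢0 : NonZero q
    q≢0 = q-nonZero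
    q>1 : NonTrivial q
    q>1 = q-nonTrivial
    q′≢0 : NonZero q′
    q′≢0 = q′-nonZero

  r : ℕ
  r = suc j % 24

  n%d≡R%d : ∀ d .{{_ : NonZero d}} → D % d ≡ 0 → n % d ≡ R % d
  n%d≡R%d d D%d≡0 = m∣n∧o%n≡p%n⇒o%m≡p%m n R (m%n≡0⇒n∣m D d D%d≡0) n%D≡R%D

  2^k%d≡2^r%d : ∀ d .{{_ : NonZero d}} → D % d ≡ 0 → (2 ^ suc j) % d ≡ (2 ^ r) % d
  2^k%d≡2^r%d d D%d≡0 = 2^k%d≡2^[k%24]%d (suc j) d (m%n≡0⇒n∣m D d D%d≡0)

  q∣p : q ∣ p
  q∣p = [m+n]%d≡n%d⇒d∣m p (2 ^ suc j) q (begin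
    (p + 2 ^ suc j) % q   ≡⟨ cong (_% q) n≡p+2^k ⟨
    n % q                 ≡⟨ n%d≡R%d q D%q≡0 ⟩
    R % q                 ≡⟨ hit ⟨
    (2 ^ r) % q           ≡⟨ 2^k%d≡2^r%d q D%q≡0 ⟨
    (2 ^ suc j) % q       ∎)

  q+2^r%q′≡R%q′ : (q + 2 ^ r) % q′ ≡ R % q′
  q+2^r%q′≡R%q′ = begin
    (q + 2 ^ r) % q′                      ≡⟨ %-distribˡ-+ q (2 ^ r) q′ ⟩
    (q % q′ + (2 ^ r) % q′) % q′          ≡⟨ cong (λ x → (q % q′ + x) % q′) (2^k%d≡2^r%d q′ D%q′≡0) ⟨
    (q % q′ + (2 ^ suc j) % q′) % q′      ≡⟨ %-distribˡ-+ q (2 ^ suc j) q′ ⟨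
    (q + 2 ^ suc j) % q′                  ≡⟨ cong (λ x → (x + 2 ^ suc j) % q′) (∣-prime⇒≡ p-prime q∣p) ⟩
    (p + 2 ^ suc j) % q′                  ≡⟨ cong (_% q′) n≡p+2^k ⟨
    n % q′                                ≡⟨ n%d≡R%d q′ D%q′≡0 ⟩
    R % q′                                ∎

lemma3 : (s : ℕ) → InU (11184810 * s + 3292241)
lemma3 s = 0<n , 2∤n , ¬RomanoffRep n (n%d≡R%d D (divides 2 refl))
  where
  n : ℕ
  n = 11184810 * s + R

  n%d≡R%d : ∀ d .{{_ : NonZero d}} → d ∣ 11184810 → n % d ≡ R % d
  n%d≡R%d d d∣M = %-remove-+ˡ R (∣-trans d∣M (m∣m*n s))

  0<n : 0 < n
  0<n = ≤-trans (s≤s z≤n) (m≤n+m R (11184810 * s))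

  2∤n : 2 ∤ n
  2∤n 2∣n = 0≢1+n (trans (sym (n∣m⇒m%n≡0 n 2 2∣n)) (n%d≡R%d 2 (divides D refl)))
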